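{- Let $u$ be a free Schur ultrafilter on a countable commutative group $G$. Then every $U\in u$ is a Schur set.
   Context: An ultrafilter $u$ on a commutative group $G$ is Schur if for each $U\in u$ there exist $a,b\in U$ with $a+b\in U$; it is free if the intersection of its members is empty. An $r$-coloring of a set $X$ is a surjective function $c:X\to\{1,\dots,r\}$; a subset is monochromatic if $c$ is constant on it. A subset $A=\{x_n:n\in\mathbb N\}$ of a countable commutative group $G$ (given with an enumeration) is called Schur if for every $r,k\in\mathbb N$ there exists a number $S(r,k)\in\mathbb N$ such that for every $r$-coloring of $X=\{x_n:n\le S(r,k)\}$ there exist $a\in X$ and $\{b_1,\dots,b_k\}\subseteq X$ such that $\{a\}\cup\{b_1,\dots,b_k\}\cup\{a+b_i:i\le k\}$ is a monochromatic subset of $X$. (Being Schur does not depend on the chosen enumeration.) -}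

module Defs where

open import Level using (0ℓ)
open import Data.Nat using (ℕ; suc)
open import Data.Fin using (Fin; toℕ)
open import Data.Product using (Σ; ∃; ∃₂; _×_; _,_)
open import Data.Sum using (_⊎_)
open import Relation.Nullary using (¬_)
open import Relation.Unary using (Pred; _∈_; _⊆_; _∩_; ∁; ∅; U)
open import Relation.Binary.PropositionalEquality using (_≡_)
open import Algebra.Structures using (IsAbelianGroup)

record CountableAbelianGroup : Set₁ where
  field
    Carrier        : Set
    _+_            : Carrier → Carrier → Carrier
    0#             : Carrier
    -_             : Carrier → Carrier
    isAbelianGroup : IsAbelianGroup _≡_ _+_ 0# -_
    enum           : ℕ → Carrier
    enum-surj      : ∀ g → ∃ λ n → enum n ≡ g

module _ (G : CountableAbelianGroup) where
  open CountableAbelianGroup G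

  Subset : Set₁
  Subset = Pred Carrier 0ℓ

  record IsUltrafilter (u : Pred Subset 0ℓ) : Set₁ where
    field
      upward : ∀ {A B} → A ∈ u → A ⊆ B → B ∈ u
      inter  : ∀ {A B} → A ∈ u → B ∈ u → (A ∩ B) ∈ u
      whole  : U ∈ u
      proper : ¬ (∅ ∈ u)
      ultra  : ∀ A → A ∈ u ⊎ ∁ A ∈ u

  IsFree : Pred Subset 0ℓ → Set₁
  IsFree u = ∀ g → ¬ (∀ A → A ∈ u → g ∈ A)

  IsSchurUltrafilter : Pred Subset 0ℓ → Set₁
  IsSchurUltrafilter u =
    ∀ A → A ∈ u → ∃₂ λ a b → a ∈ A × b ∈ A × (a + b) ∈ A

  IsEnumerationOf : Subset → (ℕ → Carrier) → Set
  IsEnumerationOf A x =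
    (∀ n → x n ∈ A) ×
    (∀ m n → x m ≡ x n → m ≡ n) ×
    (∀ g → g ∈ A → ∃ λ n → x n ≡ g)

  -- The Schur property of an enumerated set {x_n}: for all r k there is S
  -- such that every surjective r-colouring c of X = {x_n : n ≤ S}
  -- (given on indices 0..S; x is injective) admits a ∈ X and k distinct
  -- b_1..b_k ∈ X such that {a} ∪ {b_j} ∪ {a + b_j} ⊆ X is monochromatic.
  SchurProperty : (ℕ → Carrier) → Set
  SchurProperty x =
    ∀ (r k : ℕ) → ∃ λ (S : ℕ) →
      ∀ (c : Fin (suc S) → Fin r) → (∀ i → ∃ λ p → c p ≡ i) →
      Σ (Fin (suc S)) λ a → Σ (Fin k → Fin (suc S)) λ b →
        (∀ i j → b i ≡ b j → i ≡ j) ×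
        (∀ j → c (b j) ≡ c a ×
               (∃ λ p → x (toℕ p) ≡ x (toℕ a) + x (toℕ (b j)) × c p ≡ c a))

  -- A ⊆ G is Schur (for every enumeration; being Schur does not depend on it)
  IsSchurSet : Subset → Set
  IsSchurSet A = ∀ x → IsEnumerationOf A x → SchurProperty x

{-# OPTIONS --safe #-}
module Submission where

-- The ultrafilter decides every proposition, so the argument is classical. First, Schur triples
-- a, b, a + b can be taken with a ≢ b: colouring x by the parity of the length of its doubling chain
-- x, 2x, 4x, … along which the index moves monotonically (a u-limit of such parities when the index
-- increases) separates x from 2x on a set in u, and a colour class still contains a Schur triple.
-- Second, V ∈ u contains a and k distinct b with b, a + b ∈ V: otherwise the graph a ~ b ⇔ a, b,
-- a + b ∈ V has degree less than k, and a colour class of a greedy k-colouring lying in u contains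
-- such an edge. Finally, by compactness: if every S admits a colouring of x 0, …, x S without a
-- monochromatic pattern, colour x n by the u-limit of these colourings; a pattern inside a limit
-- colour class belonging to u is monochromatic for the colouring at a single large S.

open import Level using (0ℓ)
open import Algebra.Bundles using (Group)
open import Algebra.Structures using (IsAbelianGroup)
open import Data.Empty using (⊥-elim)
open import Data.Fin using (Fin; zero; suc; toℕ; fromℕ<)
open import Data.Fin.Properties using (any?; toℕ-fromℕ<; ¬Fin0)
open import Data.Maybe using (Maybe; just; nothing)
open import Data.Maybe.Properties using (just-injective)
open import Data.Nat using (ℕ; zero; suc; _≤_; _<_; _∸_; s≤s; s≤s⁻¹; _≤?_; _<?_; _≟_)
open import Data.Nat.DivMod using (_mod_; m≤n⇒m%n≡m)
open import Data.Nat.Properties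
  using (<-≤-trans; m<n⇒m<1+n; ≤∧≢⇒<; ≮⇒≥; <-cmp; m∸n≤m; ∸-monoʳ-<)
open import Data.Product using (Σ; ∃; ∃₂; _×_; _,_; proj₁; proj₂)
open import Data.Sum using (inj₁; inj₂)
open import Function using (_∘_)
open import Relation.Binary.Definitions using (tri<; tri≈; tri>)
open import Relation.Binary.PropositionalEquality
open import Relation.Nullary using (¬_; Dec; yes; no; contradiction)
open import Relation.Nullary.Decidable using (decidable-stable; _×-dec_)
open import Relation.Unary using (Pred; Decidable; _∈_; _∉_; _⊆_; _∩_; ∁; ⋃; ⋂)

open import Defs

Distinct : ∀ {X : Set} {k} → (Fin k → X) → Set
Distinct b = ∀ i j → b i ≡ b j → i ≡ j

parity : ℕ → Fin 2
parity zero = zero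
parity (suc zero) = suc zero
parity (suc (suc n)) = parity n

parity-suc≢ : ∀ n → parity (suc n) ≢ parity n
parity-suc≢ zero ()
parity-suc≢ (suc zero) ()
parity-suc≢ (suc (suc n)) = parity-suc≢ n

module Countable {X : Set} (enum : ℕ → X) (enum-surj : ∀ x → ∃ λ n → enum n ≡ x) where

  index : X → ℕ
  index x = proj₁ (enum-surj x)

  enum-index : ∀ x → enum (index x) ≡ x
  enum-index x = proj₂ (enum-surj x)

  index-injective : ∀ {x y} → index x ≡ index y → x ≡ y
  index-injective {x} {y} eq = trans (sym (enum-index x)) (trans (cong enum eq) (enum-index y))

module ChainLength {X : Set} (f : X → X) {D : Pred X 0ℓ} (D? : Decidable D)
  (μ : X → ℕ) (μ-decreasing : ∀ {x} → D x → μ (f x) < μ x) where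

  chain-length : ℕ → X → ℕ
  chain-length zero x = zero
  chain-length (suc n) x with D? x
  ... | yes _ = suc (chain-length n (f x))
  ... | no _ = zero

  chain-length-stable : ∀ {m n} x → μ x < m → μ x < n → chain-length m x ≡ chain-length n x
  chain-length-stable {suc m} {suc n} x μx<1+m μx<1+n with D? x
  ... | yes d = cong suc (chain-length-stable (f x)
                  (<-≤-trans (μ-decreasing d) (s≤s⁻¹ μx<1+m))
                  (<-≤-trans (μ-decreasing d) (s≤s⁻¹ μx<1+n)))
  ... | no _ = refl

  chain-length-step : ∀ {n x} → D x → μ x < n → chain-length n x ≡ suc (chain-length n (f x))
  chain-length-step {suc n} {x} d μx<1+n with D? x
  ... | yes _ = cong suc (chain-length-stable (f x) μfx<n (m<n⇒m<1+n μfx<n))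
    where μfx<n = <-≤-trans (μ-decreasing d) (s≤s⁻¹ μx<1+n)
  ... | no ¬d = contradiction d ¬d

  chain-parity-flips : ∀ {n x} → D x → μ x < n →
                       parity (chain-length n x) ≢ parity (chain-length n (f x))
  chain-parity-flips {n} {x} d μx<n rewrite chain-length-step d μx<n = parity-suc≢ (chain-length n (f x))

module GreedyColouring (em : (P : Set) → Dec P)
  {X : Set} (enum : ℕ → X) (enum-surj : ∀ x → ∃ λ n → enum n ≡ x)
  (E : X → X → Set) (E-sym : ∀ {x y} → E x y → E y x)
  {k : ℕ} (sparse : ∀ x → ¬ (Σ (Fin k → X) λ b → Distinct b × ∀ j → E x (b j))) where

  open Countable enum enum-surj

  Blocked : ℕ → (ℕ → Maybe (Fin k)) → Fin k → Set
  Blocked n γ j = ∃ λ y → E (enum n) y × γ (index y) ≡ just j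

  unblocked-colour : ∀ n γ → ∃ λ j → ¬ Blocked n γ j
  unblocked-colour n γ with any? (λ j → em (¬ Blocked n γ j))
  ... | yes found = found
  ... | no none = ⊥-elim (sparse (enum n) (neighbour , distinct , λ j → proj₁ (proj₂ (blocked j))))
    where
      blocked : ∀ j → Blocked n γ j
      blocked j = decidable-stable (em _) (λ unblocked → none (j , unblocked))
      neighbour : Fin k → X
      neighbour j = proj₁ (blocked j)
      distinct : Distinct neighbour
      distinct i j eq = just-injective (trans (sym (proj₂ (proj₂ (blocked i))))
                          (trans (cong (γ ∘ index) eq) (proj₂ (proj₂ (blocked j)))))

  mutual
    colour-of-index : ℕ → Fin k
    colour-of-index n = proj₁ (unblocked-colour n (colours-below n))

    colours-below : ℕ → ℕ → Maybe (Fin k)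
    colours-below zero m = nothing
    colours-below (suc n) m with m ≟ n
    ... | yes _ = just (colour-of-index n)
    ... | no _ = colours-below n m

  colours-below-correct : ∀ {m n} → m < n → colours-below n m ≡ just (colour-of-index m)
  colours-below-correct {m} {suc n} m<1+n with m ≟ n
  ... | yes refl = refl
  ... | no m≢n = colours-below-correct (≤∧≢⇒< (s≤s⁻¹ m<1+n) m≢n)

  colour : X → Fin k
  colour x = colour-of-index (index x)

  colour-separates-earlier : ∀ {x y} → index y < index x → E x y → colour x ≢ colour y
  colour-separates-earlier {x} {y} y<x e eq =
    proj₂ (unblocked-colour (index x) (colours-below (index x)))
      (y , subst (λ z → E z y) (sym (enum-index x)) e ,
       trans (colours-below-correct y<x) (cong just (sym eq)))

  proper-colouring : ∃ λ (c : X → Fin k) → ∀ {x y} → x ≢ y → E x y → c x ≢ c y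
  proper-colouring = colour , separates
    where
      separates : ∀ {x y} → x ≢ y → E x y → colour x ≢ colour y
      separates {x} {y} x≢y e with <-cmp (index x) (index y)
      ... | tri< x<y _ _ = colour-separates-earlier x<y (E-sym e) ∘ sym
      ... | tri≈ _ eq _ = contradiction (index-injective eq) x≢y
      ... | tri> _ _ y<x = colour-separates-earlier y<x e

module _ (G : CountableAbelianGroup) where
  open CountableAbelianGroup G
  open Countable enum enum-surj
  open IsAbelianGroup isAbelianGroup using (isGroup; comm)

  private
    group : Group 0ℓ 0ℓ
    group = record { Carrier = Carrier ; _≈_ = _≡_ ; _∙_ = _+_ ; ε = 0# ; _⁻¹ = -_ ; isGroup = isGroup }

  open import Algebra.Properties.Group group using (identityˡ-unique)

  MonochromaticSchurPattern : (x : ℕ → Carrier) (k : ℕ) {S r : ℕ} → (Fin (suc S) → Fin r) → Set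
  MonochromaticSchurPattern x k {S} c =
    Σ (Fin (suc S)) λ a → Σ (Fin k → Fin (suc S)) λ b → Distinct b ×
      (∀ j → c (b j) ≡ c a × (∃ λ p → x (toℕ p) ≡ x (toℕ a) + x (toℕ (b j)) × c p ≡ c a))

  module Ultrafilter (u : Pred (Subset G) 0ℓ) (isUltrafilter : IsUltrafilter G u) where
    open IsUltrafilter isUltrafilter

    finite-cover : ∀ {r} (W : Fin r → Subset G) {A} → A ∈ u → A ⊆ ⋃ (Fin r) W →
                   ∃ λ i → W i ∈ u
    finite-cover {zero} W A∈u A⊆⋃ = ⊥-elim (proper (upward A∈u (¬Fin0 ∘ proj₁ ∘ A⊆⋃)))
    finite-cover {suc r} W {A} A∈u A⊆⋃ with ultra (W zero)
    ... | inj₁ W₀∈u = zero , W₀∈u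
    ... | inj₂ ∁W₀∈u with finite-cover (W ∘ suc) (inter A∈u ∁W₀∈u) rest
      where
        rest : A ∩ ∁ (W zero) ⊆ ⋃ (Fin r) (W ∘ suc)
        rest (a , ¬w₀) with A⊆⋃ a
        ... | zero , w₀ = contradiction w₀ ¬w₀
        ... | suc i , w = i , w
    ... | i , Wi∈u = suc i , Wi∈u

    colour-class : ∀ {r} (c : Carrier → Fin r) {A} → A ∈ u →
                   ∃ λ i → (λ x → A x × c x ≡ i) ∈ u
    colour-class c A∈u = finite-cover _ A∈u (λ {x} a → c x , a , refl)

    ⋂-∈ : ∀ {t} (W : Fin t → Subset G) → (∀ s → W s ∈ u) → ⋂ (Fin t) W ∈ u
    ⋂-∈ {zero} W _ = upward whole (λ _ ())
    ⋂-∈ {suc t} W W∈u = upward (inter (W∈u zero) (⋂-∈ (W ∘ suc) (W∈u ∘ suc)))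
      λ { (w₀ , w) zero → w₀ ; (w₀ , w) (suc s) → w s }

    -- lim x is the u-limit of F m x, taking m = index g.
    module Limit {I : Set} {r : ℕ} (F : ℕ → I → Fin r) where

      limit-class : ∀ x → ∃ λ i → (λ g → F (index g) x ≡ i) ∈ u
      limit-class x = finite-cover (λ i g → F (index g) x ≡ i) whole (λ _ → F _ x , refl)

      lim : I → Fin r
      lim x = proj₁ (limit-class x)

      lim-agrees : ∀ x → (λ g → F (index g) x ≡ lim x) ∈ u
      lim-agrees x = proj₂ (limit-class x)

  module SchurUltrafilter (u : Pred (Subset G) 0ℓ) (isUltrafilter : IsUltrafilter G u)
    (free : IsFree G u) (schur : IsSchurUltrafilter G u) where
    open IsUltrafilter isUltrafilter
    open Ultrafilter u isUltrafilter

    inhabited : ∀ {A} → A ∈ u → ∃ A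
    inhabited {A} A∈u with schur A A∈u
    ... | a , _ , a∈A , _ = a , a∈A

    -- Either λ _ → P or its complement is in u, hence inhabited.
    excluded-middle : (P : Set) → Dec P
    excluded-middle P with ultra (λ _ → P)
    ... | inj₁ P∈u = yes (proj₂ (inhabited P∈u))
    ... | inj₂ ¬P∈u = no (proj₂ (inhabited ¬P∈u))

    singleton∉ : ∀ h → (λ g → g ≡ h) ∉ u
    singleton∉ h h∈u = free h (λ A A∈u → member (inhabited (inter A∈u h∈u)))
      where
        member : ∀ {A} → ∃ (A ∩ (λ g → g ≡ h)) → A h
        member (_ , a , refl) = a

    cosingleton∈ : ∀ h → (λ g → g ≢ h) ∈ u
    cosingleton∈ h with ultra (λ g → g ≡ h)
    ... | inj₁ h∈u = contradiction h∈u (singleton∉ h)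
    ... | inj₂ ∁h∈u = ∁h∈u

    cofinite∈ : ∀ N → (λ g → N ≤ index g) ∈ u
    cofinite∈ N with ultra (λ g → index g < N)
    ... | inj₂ unbounded∈u = upward unbounded∈u ≮⇒≥
    ... | inj₁ bounded∈u with finite-cover (λ i g → g ≡ enum (toℕ i)) bounded∈u
                                (λ {g} g<N → fromℕ< g<N , trans (sym (enum-index g))
                                                            (cong enum (sym (toℕ-fromℕ< g<N))))
    ... | i , singleton∈u = contradiction singleton∈u (singleton∉ (enum (toℕ i)))

    open Limit

    lim-separates : ∀ {r} (F : ℕ → Carrier → Fin r) (f : Carrier → Carrier) {R : Subset G} →
      R ∈ u →
      (∀ {x} → R x → ∃ λ N → ∀ {m} → N ≤ m → F m x ≢ F m (f x)) →
      (λ x → lim F x ≢ lim F (f x)) ∈ u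
    lim-separates F f {R} R∈u eventually-separated = upward R∈u separated
      where
        separated : ∀ {x} → R x → lim F x ≢ lim F (f x)
        separated {x} Rx lim-eq with eventually-separated Rx
        ... | N , separated-from-N
            with inhabited (inter (cofinite∈ N) (inter (lim-agrees F x) (lim-agrees F (f x))))
        ... | g , N≤g , agree-x , agree-fx =
              separated-from-N N≤g (trans agree-x (trans lim-eq (sym agree-fx)))

    fixed-point-free-colouring : (f : Carrier → Carrier) → (λ x → f x ≢ x) ∈ u →
      ∃ λ (c : Carrier → Fin 2) → (λ x → c x ≢ c (f x)) ∈ u
    fixed-point-free-colouring f moves with ultra (λ x → index (f x) < index x)
    ... | inj₁ descending∈u =
          lim F , lim-separates F f descending∈u
                    (λ {x} d → index x , λ x≤m → chain-parity-flips d (s≤s x≤m))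
      where
        open ChainLength f (λ x → index (f x) <? index x) index (λ d → d)
        F : ℕ → Carrier → Fin 2
        F m = parity ∘ chain-length (suc m)
    ... | inj₂ ¬descending∈u =
          lim F , lim-separates F f (inter moves ¬descending∈u) eventually-flips
      where
        -- Along an ascending chain the index grows without bound, so only its part below m is counted.
        module Ascending (m : ℕ) = ChainLength f (λ x → (index x <? index (f x)) ×-dec (index (f x) ≤? m))
                                     (λ x → m ∸ index x) (λ (x<fx , fx≤m) → ∸-monoʳ-< x<fx fx≤m)
        F : ℕ → Carrier → Fin 2
        F m = parity ∘ Ascending.chain-length m (suc m)
        eventually-flips : ∀ {x} → f x ≢ x × ¬ index (f x) < index x →
                           ∃ λ N → ∀ {m} → N ≤ m → F m x ≢ F m (f x)
        eventually-flips {x} (fx≢x , ¬fx<x) =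
          index (f x) , λ {m} fx≤m →
            Ascending.chain-parity-flips m (x<fx , fx≤m) (s≤s (m∸n≤m m (index x)))
          where
            x<fx : index x < index (f x)
            x<fx = ≤∧≢⇒< (≮⇒≥ ¬fx<x) (λ eq → fx≢x (sym (index-injective eq)))

    distinct-Schur-triple : ∀ {V} → V ∈ u → ∃₂ λ a b → a ≢ b × V a × V b × V (a + b)
    distinct-Schur-triple {V} V∈u with fixed-point-free-colouring (λ x → x + x) doubling-moves
      where
        doubling-moves : (λ x → x + x ≢ x) ∈ u
        doubling-moves = upward (cosingleton∈ 0#) (λ x≢0 → x≢0 ∘ identityˡ-unique _ _)
    ... | c , c-flips∈u with colour-class c (inter V∈u c-flips∈u)
    ... | i , class∈u with schur _ class∈u
    ... | a , b , ((va , flips) , ca) , ((vb , _) , cb) , ((vab , _) , cab) = a , b , a≢b , va , vb , vab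
      where
        a≢b : a ≢ b
        a≢b refl = flips (trans ca (sym cab))

    monochromatic-distinct-triple : ∀ {r V} → V ∈ u → (c : Carrier → Fin r) →
      ∃₂ λ a b → a ≢ b × V a × V b × V (a + b) × c a ≡ c b
    monochromatic-distinct-triple V∈u c with colour-class c V∈u
    ... | i , class∈u with distinct-Schur-triple class∈u
    ... | a , b , a≢b , (va , ca) , (vb , cb) , (vab , _) = a , b , a≢b , va , vb , vab , trans ca (sym cb)

    SchurConfiguration : ℕ → Subset G → Set
    SchurConfiguration k V =
      Σ Carrier λ a → Σ (Fin k → Carrier) λ b → V a × Distinct b × ∀ j → V (b j) × V (a + b j)

    -- Without a configuration every a ∈ V has at most k partners b with b, a + b ∈ V.
    separating-colouring : ∀ {k V} → ¬ SchurConfiguration (suc k) V →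
      ∃ λ (c : Carrier → Fin (suc k)) → ∀ {a b} → a ≢ b → V a × V b × V (a + b) → c a ≢ c b
    separating-colouring {k} {V} none =
      GreedyColouring.proper-colouring excluded-middle enum enum-surj
        (λ a b → V a × V b × V (a + b))
        (λ (va , vb , vab) → vb , va , subst V (comm _ _) vab)
        (λ a (b , distinct , edges) →
           none (a , b , proj₁ (edges zero) , distinct , proj₂ ∘ edges))

    Schur-configuration : ∀ k {V} → V ∈ u → SchurConfiguration k V
    Schur-configuration zero V∈u with inhabited V∈u
    ... | a , va = a , (λ ()) , va , (λ ()) , (λ ())
    Schur-configuration (suc k) {V} V∈u with excluded-middle (SchurConfiguration (suc k) V)
    ... | yes found = found
    ... | no none with separating-colouring none
    ... | c , separates with monochromatic-distinct-triple V∈u c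
    ... | a , b , a≢b , va , vb , vab , ca≡cb = contradiction ca≡cb (separates a≢b (va , vb , vab))

    module Compactness {A} (A∈u : A ∈ u)
      (x : ℕ → Carrier) (x-onto : ∀ g → A g → ∃ λ n → x n ≡ g)
      {r : ℕ} (colouring : (S : ℕ) → Fin (suc S) → Fin r) where

      F : ℕ → ℕ → Fin r
      F S n = colouring S (n mod suc S)

      record LimitClass (i : Fin r) (g : Carrier) : Set where
        constructor at
        field
          position : ℕ
          x-position : x position ≡ g
          position-colour : lim F position ≡ i

      record LimitConfiguration (k : ℕ) : Set where
        field
          base : ℕ
          summand sum : Fin k → ℕ
          summand-distinct : Distinct (x ∘ summand)
          sum-correct : ∀ j → x (sum j) ≡ x base + x (summand j)
          summand-colour : ∀ j → lim F (summand j) ≡ lim F base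
          sum-colour : ∀ j → lim F (sum j) ≡ lim F base

      limit-configuration : ∀ k → LimitConfiguration k
      limit-configuration k with finite-cover LimitClass A∈u
                                   (λ {g} g∈A → let n , xn≡g = x-onto g g∈A in lim F n , at n xn≡g refl)
      ... | i , class∈u with Schur-configuration k class∈u
      ... | a , b , at n xn≡a n-colour , b-distinct , in-class = record
            { base = n
            ; summand = position ∘ summand-class
            ; sum = position ∘ sum-class
            ; summand-distinct = λ i j eq →
                b-distinct i j (trans (sym (x-position (summand-class i)))
                                 (trans eq (x-position (summand-class j))))
            ; sum-correct = λ j → trans (x-position (sum-class j))
                                    (sym (cong₂ _+_ xn≡a (x-position (summand-class j))))
            ; summand-colour = λ j → trans (position-colour (summand-class j)) (sym n-colour)
            ; sum-colour = λ j → trans (position-colour (sum-class j)) (sym n-colour)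
            }
        where
          open LimitClass
          summand-class : ∀ j → LimitClass i (b j)
          summand-class = proj₁ ∘ in-class
          sum-class : ∀ j → LimitClass i (a + b j)
          sum-class = proj₂ ∘ in-class

      Settled : ℕ → ℕ → Set
      Settled S n = n ≤ S × F S n ≡ lim F n

      settled∈ : ∀ n → (λ g → Settled (index g) n) ∈ u
      settled∈ n = inter (cofinite∈ n) (lim-agrees F n)

      settled-pattern : ∀ {k} (C : LimitConfiguration k) {S} → let open LimitConfiguration C in
        Settled S base → (∀ j → Settled S (summand j)) → (∀ j → Settled S (sum j)) →
        MonochromaticSchurPattern x k (colouring S)
      settled-pattern C {S} base-settled summand-settled sum-settled =
        base mod suc S , (λ j → summand j mod suc S) , distinct ,
        λ j → same-colour (summand-settled j) (summand-colour j) ,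
              sum j mod suc S , sum-eq j , same-colour (sum-settled j) (sum-colour j)
        where
          open LimitConfiguration C
          open ≡-Reasoning

          x-mod : ∀ {n} → Settled S n → x (toℕ (n mod suc S)) ≡ x n
          x-mod (n≤S , _) = cong x (trans (toℕ-fromℕ< _) (m≤n⇒m%n≡m n≤S))

          same-colour : ∀ {n} → Settled S n → lim F n ≡ lim F base → F S n ≡ F S base
          same-colour (_ , Fn≡lim) eq = trans Fn≡lim (trans eq (sym (proj₂ base-settled)))

          distinct : Distinct (λ j → summand j mod suc S)
          distinct i j eq = summand-distinct i j
            (trans (sym (x-mod (summand-settled i))) (trans (cong (x ∘ toℕ) eq) (x-mod (summand-settled j))))

          sum-eq : ∀ j → x (toℕ (sum j mod suc S)) ≡
                         x (toℕ (base mod suc S)) + x (toℕ (summand j mod suc S))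
          sum-eq j = begin
            x (toℕ (sum j mod suc S))  ≡⟨ x-mod (sum-settled j) ⟩
            x (sum j)                  ≡⟨ sum-correct j ⟩
            x base + x (summand j)     ≡⟨ cong₂ _+_ (x-mod base-settled) (x-mod (summand-settled j)) ⟨
            x (toℕ (base mod suc S)) + x (toℕ (summand j mod suc S)) ∎

      some-colouring-has-pattern : ∀ k → ∃ λ S → MonochromaticSchurPattern x k (colouring S)
      some-colouring-has-pattern k
        with inhabited (inter (settled∈ base)
                              (inter (⋂-∈ _ (settled∈ ∘ summand)) (⋂-∈ _ (settled∈ ∘ sum))))
        where open LimitConfiguration (limit-configuration k)
      ... | g , base-settled , summand-settled , sum-settled =
            index g , settled-pattern (limit-configuration k) base-settled summand-settled sum-settled

    Schur-set : ∀ {A} → A ∈ u → IsSchurSet G A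
    Schur-set A∈u x (_ , _ , x-onto) r k = decidable-stable (excluded-middle _) refute
      where
        refute : ¬ ¬ ∃ λ S → ∀ (c : Fin (suc S) → Fin r) → (∀ i → ∃ λ p → c p ≡ i) →
                             MonochromaticSchurPattern x k c
        refute none = let S , found = Compactness.some-colouring-has-pattern A∈u x x-onto (proj₁ ∘ bad) k
                      in proj₂ (bad S) found
          where
            bad : ∀ S → Σ (Fin (suc S) → Fin r) λ c → ¬ MonochromaticSchurPattern x k c
            bad S = decidable-stable (excluded-middle _) λ no-bad →
                      none (S , λ c _ → decidable-stable (excluded-middle _) λ no-pattern →
                                          no-bad (c , no-pattern))

proposition2p2 : (G : CountableAbelianGroup) (u : Pred (Subset G) 0ℓ) →
    IsUltrafilter G u → IsFree G u → IsSchurUltrafilter G u →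
    ∀ A → A ∈ u → IsSchurSet G A
proposition2p2 G u isUltrafilter free schur A = SchurUltrafilter.Schur-set G u isUltrafilter free schur
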